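{- Let $a,b,c\ge 2$ be integers. Then (i) $F(c)\le 3F(a)F(b)$ if and only if $c\le a+b$; (ii) $F(c)>3F(a)F(b)$ if and only if $c\ge a+b+1$; (iii) $F(c)=3F(a)F(b)$ if and only if $a=b=2$ and $c=4$.
   Context: $F(n)$ denotes the $n$-th Fibonacci number, $F(0)=0$, $F(1)=1$, $F(n+1)=F(n)+F(n-1)$. -}

module Defs where

open import Data.Nat using (ℕ; zero; suc; _+_)

F : ℕ → ℕ
F zero = 0
F (suc zero) = 1
F (suc (suc n)) = F (suc n) + F n

{-# OPTIONS --safe #-}
-- Both bounds come from exact identities. For a = 2 + m, b = 2 + n the addition formula gives
--   F (a + b) + F m F b + F n F a = 3 F a F b,
--   F (a + b + 1) + F m F n = 3 F a F b + 2 F (a - 1) F (b - 1),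
-- so F (a + b) ≤ 3 F a F b with equality exactly when F m = F n = 0, i.e. a = b = 2, while
-- F (a + b + 1) > 3 F a F b. As F is increasing, and strictly so from index 2, this decides every c.
module Submission where

open import Defs
open import Data.Nat using (ℕ; zero; suc; _+_; _*_; _≤_; _<_; _≥_; _>_; z≤n; s≤s; _≤′_; ≤′-refl; ≤′-step; >-nonZero)
open import Data.Nat.Properties
open import Data.Nat.Tactic.RingSolver using (solve-∀)
open import Data.Product using (_×_; _,_)
open import Function.Base using (_∘′_)
open import Function.Bundles using (_⇔_; mk⇔)
open import Relation.Nullary using (contradiction)
open import Relation.Binary.PropositionalEquality using (_≡_; refl; sym; trans; cong; subst; module ≡-Reasoning)

F-add : ∀ m n → F (suc (m + n)) ≡ F (suc m) * F (suc n) + F m * F n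
F-add zero n = sym (trans (+-identityʳ (1 * F (suc n))) (*-identityˡ (F (suc n))))
F-add (suc m) n = begin
  F (suc (suc m + n))                                   ≡⟨ cong (λ k → F (suc k)) (sym (+-suc m n)) ⟩
  F (suc (m + suc n))                                   ≡⟨ F-add m (suc n) ⟩
  F (suc m) * F (suc (suc n)) + F m * F (suc n)         ≡⟨ regroup (F (suc m)) (F m) (F (suc n)) (F n) ⟩
  F (suc (suc m)) * F (suc n) + F (suc m) * F n         ∎
  where
    open ≡-Reasoning
    regroup : ∀ p q r s → p * (r + s) + q * r ≡ (p + q) * r + p * s
    regroup = solve-∀

F[1+n]>0 : ∀ n → F (suc n) > 0
F[1+n]>0 zero    = s≤s z≤n
F[1+n]>0 (suc n) = ≤-trans (F[1+n]>0 n) (m≤m+n _ _)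

F[n]≡0⇒n≡0 : ∀ {n} → F n ≡ 0 → n ≡ 0
F[n]≡0⇒n≡0 {zero}  _      = refl
F[n]≡0⇒n≡0 {suc n} F[n]≡0 = contradiction F[n]≡0 (>⇒≢ (F[1+n]>0 n))

F[n]≤F[1+n] : ∀ n → F n ≤ F (suc n)
F[n]≤F[1+n] zero          = z≤n
F[n]≤F[1+n] (suc zero)    = ≤-refl
F[n]≤F[1+n] (suc (suc n)) = m≤m+n _ _

F[2+n]<F[3+n] : ∀ n → F (2 + n) < F (3 + n)
F[2+n]<F[3+n] n = m<m+n (F (2 + n)) (F[1+n]>0 n)

F-mono-≤ : ∀ {m n} → m ≤ n → F m ≤ F n
F-mono-≤ = F-mono-≤′ ∘′ ≤⇒≤′
  where
    F-mono-≤′ : ∀ {m n} → m ≤′ n → F m ≤ F n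
    F-mono-≤′ ≤′-refl          = ≤-refl
    F-mono-≤′ (≤′-step {n} m≤n) = ≤-trans (F-mono-≤′ m≤n) (F[n]≤F[1+n] n)

F-mono-< : ∀ {m n} → 2 ≤ m → m < n → F m < F n
F-mono-< {suc (suc k)} (s≤s (s≤s z≤n)) m<n = <-≤-trans (F[2+n]<F[3+n] k) (F-mono-≤ m<n)

F[a+b]+defect≡3F[a]F[b] : ∀ m n →
  F (2 + m + (2 + n)) + (F m * F (2 + n) + F n * F (2 + m)) ≡ 3 * F (2 + m) * F (2 + n)
F[a+b]+defect≡3F[a]F[b] m n = begin
  F (2 + m + (2 + n)) + defect                                ≡⟨ cong (_+ defect) (F-add (1 + m) (2 + n)) ⟩
  F (2 + m) * F (3 + n) + F (1 + m) * F (2 + n) + defect      ≡⟨ expand (F (1 + m)) (F m) (F (1 + n)) (F n) ⟩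
  3 * F (2 + m) * F (2 + n)                                   ∎
  where
    open ≡-Reasoning
    defect = F m * F (2 + n) + F n * F (2 + m)
    expand : ∀ A a B b →
      (A + a) * ((B + b) + B) + A * (B + b) + (a * (B + b) + b * (A + a)) ≡ 3 * (A + a) * (B + b)
    expand = solve-∀

F[1+a+b]+F[m]F[n]≡3F[a]F[b]+2F[1+m]F[1+n] : ∀ m n →
  F (suc (2 + m + (2 + n))) + F m * F n ≡ 3 * F (2 + m) * F (2 + n) + 2 * (F (1 + m) * F (1 + n))
F[1+a+b]+F[m]F[n]≡3F[a]F[b]+2F[1+m]F[1+n] m n = begin
  F (suc (2 + m + (2 + n))) + F m * F n                            ≡⟨ cong (_+ F m * F n) (F-add (2 + m) (2 + n)) ⟩
  F (3 + m) * F (3 + n) + F (2 + m) * F (2 + n) + F m * F n        ≡⟨ expand (F (1 + m)) (F m) (F (1 + n)) (F n) ⟩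
  3 * F (2 + m) * F (2 + n) + 2 * (F (1 + m) * F (1 + n))          ∎
  where
    open ≡-Reasoning
    expand : ∀ A a B b →
      ((A + a) + A) * ((B + b) + B) + (A + a) * (B + b) + a * b ≡ 3 * (A + a) * (B + b) + 2 * (A * B)
    expand = solve-∀

F[a+b]≤3F[a]F[b] : ∀ m n → F (2 + m + (2 + n)) ≤ 3 * F (2 + m) * F (2 + n)
F[a+b]≤3F[a]F[b] m n =
  subst (F (2 + m + (2 + n)) ≤_) (F[a+b]+defect≡3F[a]F[b] m n) (m≤m+n _ _)

F[a+b]≡3F[a]F[b]⇒a≡b≡2 : ∀ m n → F (2 + m + (2 + n)) ≡ 3 * F (2 + m) * F (2 + n) → m ≡ 0 × n ≡ 0
F[a+b]≡3F[a]F[b]⇒a≡b≡2 m n eq =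
    F[n]≡0⇒n≡0 (m*n≡0⇒m≡0 (F m) (F (2 + n)) {{>-nonZero (F[1+n]>0 (1 + n))}} (m+n≡0⇒m≡0 _ defect≡0))
  , F[n]≡0⇒n≡0 (m*n≡0⇒m≡0 (F n) (F (2 + m)) {{>-nonZero (F[1+n]>0 (1 + m))}} (m+n≡0⇒n≡0 _ defect≡0))
  where
    defect≡0 : F m * F (2 + n) + F n * F (2 + m) ≡ 0
    defect≡0 = +-cancelˡ-≡ (F (2 + m + (2 + n))) _ 0
      (trans (F[a+b]+defect≡3F[a]F[b] m n) (trans (sym eq) (sym (+-identityʳ _))))

3F[a]F[b]<F[1+a+b] : ∀ m n → 3 * F (2 + m) * F (2 + n) < F (suc (2 + m + (2 + n)))
3F[a]F[b]<F[1+a+b] m n = +-cancelʳ-< (F m * F n) _ _ (begin-strict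
  T + F m * F n      ≤⟨ +-monoʳ-≤ T (*-mono-≤ (F[n]≤F[1+n] m) (F[n]≤F[1+n] n)) ⟩
  T + Q              <⟨ +-monoʳ-< T (m<m*n Q 2 {{>-nonZero Q>0}} (s≤s (s≤s z≤n))) ⟩
  T + Q * 2          ≡⟨ cong (T +_) (*-comm Q 2) ⟩
  T + 2 * Q          ≡⟨ sym (F[1+a+b]+F[m]F[n]≡3F[a]F[b]+2F[1+m]F[1+n] m n) ⟩
  F (suc (2 + m + (2 + n))) + F m * F n ∎)
  where
    open ≤-Reasoning
    T = 3 * F (2 + m) * F (2 + n)
    Q = F (1 + m) * F (1 + n)
    Q>0 : Q > 0
    Q>0 = *-mono-≤ (F[1+n]>0 m) (F[1+n]>0 n)

lemma2p4 : (a b c : ℕ) → 2 ≤ a → 2 ≤ b → 2 ≤ c →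
    ((F c ≤ 3 * F a * F b) ⇔ (c ≤ a + b))
    × ((F c > 3 * F a * F b) ⇔ (c ≥ a + b + 1))
    × ((F c ≡ 3 * F a * F b) ⇔ (a ≡ 2 × b ≡ 2 × c ≡ 4))
lemma2p4 .(2 + m) .(2 + n) c (s≤s (s≤s (z≤n {m}))) (s≤s (s≤s (z≤n {n}))) 2≤c =
  mk⇔ F[c]≤T⇒c≤a+b c≤a+b⇒F[c]≤T ,
  mk⇔ (λ T<F[c] → subst (_≤ c) (+-comm 1 (a + b)) (≰⇒> (<⇒≱ T<F[c] ∘′ c≤a+b⇒F[c]≤T)))
      (λ a+b+1≤c → a+b<c⇒T<F[c] (subst (_≤ c) (+-comm (a + b) 1) a+b+1≤c)) ,
  mk⇔ F[c]≡T⇒ (λ { (refl , refl , refl) → refl })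
  where
    a = 2 + m
    b = 2 + n
    T = 3 * F a * F b
    c≤a+b⇒F[c]≤T : c ≤ a + b → F c ≤ T
    c≤a+b⇒F[c]≤T c≤a+b = ≤-trans (F-mono-≤ c≤a+b) (F[a+b]≤3F[a]F[b] m n)
    a+b<c⇒T<F[c] : a + b < c → T < F c
    a+b<c⇒T<F[c] a+b<c = <-≤-trans (3F[a]F[b]<F[1+a+b] m n) (F-mono-≤ a+b<c)
    F[c]≤T⇒c≤a+b : F c ≤ T → c ≤ a + b
    F[c]≤T⇒c≤a+b F[c]≤T = ≮⇒≥ (≤⇒≯ F[c]≤T ∘′ a+b<c⇒T<F[c])
    F[c]≡T⇒c≡a+b : F c ≡ T → c ≡ a + b
    F[c]≡T⇒c≡a+b eq = ≤∧≮⇒≡ (F[c]≤T⇒c≤a+b (≤-reflexive eq))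
      (λ c<a+b → <⇒≢ (<-≤-trans (F-mono-< 2≤c c<a+b) (F[a+b]≤3F[a]F[b] m n)) eq)
    F[c]≡T⇒ : F c ≡ T → a ≡ 2 × b ≡ 2 × c ≡ 4
    F[c]≡T⇒ eq with F[c]≡T⇒c≡a+b eq
    ... | refl with F[a+b]≡3F[a]F[b]⇒a≡b≡2 m n eq
    ...   | refl , refl = refl , refl , refl
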